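{- For every index $\mathbf s\in\mathbf I^{\mathrm{ext}}$, $$\zeta_{\mathcal A_K}(\mathbf s)=\bigl(H_{<\deg v}(\mathbf s;\lambda_v)\bmod \lambda_v\bigr)_v\in\mathcal A_K,$$ where $v$ ranges over the monic irreducible polynomials of $A$.
   Context: Let $r$ be a power of a prime $p$, $A=\mathbb F_r[\theta]$, $K=\mathbb F_r(\theta)$, $\mathbb C_\infty$ the completion of an algebraic closure of $\mathbb F_r((1/\theta))$. $A_+$ is the set of monic polynomials, $A_{+,d}$ the monic polynomials of degree $d$. The Carlitz module is $a\mapsto\mathbf C_a(X)=\sum_{i=0}^{\deg a}[a,i]X^{r^i}\in A[X]$, the $\mathbb F_r$-algebra map determined by $\mathbf C_\theta(X)=\theta X+X^r$; $\exp_{\mathbf C}(X)=\sum_{i\ge0}X^{r^i}/D_i$ with $D_i=\prod_{j=0}^{i-1}(\theta^{r^i}-\theta^{r^j})$, $\tilde\pi$ is the Carlitz period ($\ker\exp_{\mathbf C}=\tilde\pi A$), and for $v\in A_+$, $\lambda_v=\exp_{\mathbf C}(\tilde\pi/v)$, a generator of the $v$-torsion $\{u:\mathbf C_v(u)=0\}$. The $u$-bracket is $[a]_u=\mathbf C_a(u)/u$. $\mathbf I^{\mathrm{ext}}$ is the set of finite tuples of integers including $\varnothing$. For $s,d\in\mathbb Z$: $S_d(s)=\sum_{a\in A_{+,d}}a^{ -s}$, $H_d(s;u)=\sum_{a\in A_{+,d}}[a]_u^{ -s}$; for $\mathbf s=(s_1,\dots,s_m)\ne\varnothing$: $S_{<d}(\mathbf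 s)=\sum_{d>d_1>\cdots>d_m\ge0}\prod_jS_{d_j}(s_j)$, $H_{<d}(\mathbf s;u)=\sum_{d>d_1>\cdots>d_m\ge0}\prod_jH_{d_j}(s_j;u)$; both are $1$ at $\varnothing$. Let $\mathcal A_K=\bigl(\prod_v\mathbb F_v\bigr)/\bigl(\bigoplus_v\mathbb F_v\bigr)$, $v$ over monic irreducibles, $\mathbb F_v=A/(v)$, and $\zeta_{\mathcal A_K}(\mathbf s)=(S_{<\deg v}(\mathbf s)\bmod v)_v\in\mathcal A_K$ (with $\zeta_{\mathcal A_K}(\varnothing)=(1)_v$). In the statement, $H_{<\deg v}(\mathbf s;\lambda_v)$ is an element of $A[\lambda_v]$, and its reduction modulo the prime ideal $(\lambda_v)$ of $A[\lambda_v]$ is regarded as an element of $\mathbb F_v$ via the isomorphism $A/(v)\cong A[\lambda_v]/(\lambda_v)$ induced by inclusion. -}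

module Defs where

open import Level using (0ℓ)
open import Data.Nat using (ℕ; zero; suc; _<_; _≤_)
open import Data.Integer using (ℤ; +_; -[1+_])
open import Data.List using (List; []; _∷_; map; foldr; concatMap; length; drop; _++_)
open import Data.List.Membership.Propositional using (_∈_)
open import Data.List.Relation.Unary.All using (All)
open import Data.List.Relation.Unary.Unique.Propositional using (Unique)
open import Data.Vec using (Vec; toList) renaming ([] to []ᵥ; _∷_ to _∷ᵥ_)
open import Data.Product using (Σ; _×_)
open import Data.Sum using (_⊎_)
open import Relation.Binary.PropositionalEquality using (_≡_; _≢_)
open import Algebra.Structures using (IsCommutativeRing)

record FiniteField : Set₁ where
  infixl 6 _+_
  infixl 7 _*_
  field
    F      : Set
    _+_    : F → F → F
    _*_    : F → F → F
    -_     : F → F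
    0F 1F  : F
    isCommutativeRing : IsCommutativeRing _≡_ _+_ _*_ -_ 0F 1F
    0≢1    : 0F ≢ 1F
    inv    : F → F
    inv-r  : ∀ x → x ≢ 0F → x * inv x ≡ 1F
    elems    : List F
    complete : ∀ x → x ∈ elems
    unique   : Unique elems

  r : ℕ
  r = length elems

-- Generic dense polynomials (coefficient lists, lowest degree first;
-- trailing zeros allowed, equality is up to a zero difference).

module PolyOps {R : Set} (0R 1R : R) (_⊕_ _⊗_ : R → R → R) (⊖_ : R → R) where
  Pol : Set
  Pol = List R

  _+P_ : Pol → Pol → Pol
  [] +P q = q
  (a ∷ p) +P [] = a ∷ p
  (a ∷ p) +P (b ∷ q) = (a ⊕ b) ∷ (p +P q)

  scale : R → Pol → Pol
  scale c p = map (c ⊗_) p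

  _*P_ : Pol → Pol → Pol
  [] *P q = []
  (a ∷ p) *P q = scale a q +P (0R ∷ (p *P q))

  -P_ : Pol → Pol
  -P p = map ⊖_ p

  _-P_ : Pol → Pol → Pol
  p -P q = p +P (-P q)

  0P 1P : Pol
  0P = []
  1P = 1R ∷ []

  _^P_ : Pol → ℕ → Pol
  p ^P zero = 1P
  p ^P suc n = p *P (p ^P n)

  constTerm : Pol → R
  constTerm [] = 0R
  constTerm (a ∷ _) = a

-- Generic iterated sums S_d, S_{<d} over monic polynomials, given
-- the value  term a s  of "a^{-s}" (resp. "[a]_u^{-s}") for a monic a.

module IterSums {F R : Set} (elems : List F) (0R 1R : R) (_⊕_ _⊗_ : R → R → R)
                (term : ∀ {e} → Vec F e → ℤ → R) where

  -- all monic polynomials of degree d, given by their d lower coefficients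
  monics : (d : ℕ) → List (Vec F d)
  monics zero = []ᵥ ∷ []
  monics (suc d) = concatMap (λ x → map (x ∷ᵥ_) (monics d)) elems

  sumR : List R → R
  sumR = foldr _⊕_ 0R

  Sd : ℕ → ℤ → R
  Sd d s = sumR (map (λ a → term a s) (monics d))

  -- S_{<d}(s_1,…,s_m) = Σ_{d > d_1 > … > d_m ≥ 0} Π_j S_{d_j}(s_j)
  S< : ℕ → List ℤ → R
  S< d [] = 1R
  S< zero (s ∷ ss) = 0R
  S< (suc d) (s ∷ ss) = S< d (s ∷ ss) ⊕ (Sd d s ⊗ S< d ss)

module _ (𝔽 : FiniteField) where
  open FiniteField 𝔽

  open PolyOps 0F 1F _+_ _*_ -_ public
    renaming (Pol to Poly)

  open PolyOps {Poly} 0P 1P _+P_ _*P_ -P_ public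
    renaming (Pol to PolyX; _+P_ to _+X_; _*P_ to _*X_; -P_ to -X_; _-P_ to _-X_;
              0P to 0X; 1P to 1X; _^P_ to _^X_; scale to scaleX; constTerm to constTermX)

  monicPoly : ∀ {d} → Vec F d → Poly
  monicPoly c = toList c ++ (1F ∷ [])

  IsZero : Poly → Set
  IsZero p = All (_≡ 0F) p

  IsZeroX : PolyX → Set
  IsZeroX f = All IsZero f

  _∣A_ : Poly → Poly → Set
  v ∣A f = Σ Poly λ c → IsZero ((c *P v) -P f)

  _∣X_ : PolyX → PolyX → Set
  g ∣X f = Σ PolyX λ c → IsZeroX ((c *X g) -X f)

  CongA : Poly → Poly → Poly → Set
  CongA v f g = v ∣A (f -P g)

  IrreducibleMonic : ∀ {d} → Vec F d → Set
  IrreducibleMonic {d} v =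
    (1 Data.Nat.≤ d) ×
    (∀ e (b : Vec F e) → monicPoly b ∣A monicPoly v → (e ≡ 0) ⊎ (e ≡ d))

  θ : Poly
  θ = 0F ∷ 1F ∷ []

  Xv : PolyX
  Xv = 0P ∷ 1P ∷ []

  Cθ : PolyX → PolyX
  Cθ f = scaleX θ f +X (f ^X r)

  -- Carlitz module: C_{c + θ a}(X) = c X + C_θ(C_a(X))
  carlitz : Poly → PolyX
  carlitz [] = 0X
  carlitz (c ∷ a) = scaleX (c ∷ []) Xv +X Cθ (carlitz a)

  -- [a]_X = C_a(X)/X  (C_a(X) has zero constant term)
  bracket : Poly → PolyX
  bracket a = drop 1 (carlitz a)

  -- Φ_v(X) = C_v(X)/X, minimal polynomial of λ_v; A[λ_v] ≅ A[X]/(Φ_v)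
  Φ : Poly → PolyX
  Φ v = bracket v

  -- inverse oracles: ι a is an inverse of a in A/(v); κ a an inverse of
  -- [a]_X in A[X]/(Φ_v), for all monic a with deg a < deg v
  InvOracleA : ∀ {d} → Vec F d → (∀ {e} → Vec F e → Poly) → Set
  InvOracleA {d} v ι = ∀ e → e < d → (a : Vec F e) →
    CongA (monicPoly v) (monicPoly a *P ι a) 1P

  InvOracleX : ∀ {d} → Vec F d → (∀ {e} → Vec F e → PolyX) → Set
  InvOracleX {d} v κ = ∀ e → e < d → (a : Vec F e) →
    Φ (monicPoly v) ∣X ((bracket (monicPoly a) *X κ a) -X 1X)

  -- a^{-s} in A/(v)
  termA : (∀ {e} → Vec F e → Poly) → ∀ {e} → Vec F e → ℤ → Poly
  termA ι a (+ n) = ι a ^P n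
  termA ι a -[1+ n ] = monicPoly a ^P suc n

  -- [a]_X^{-s} in A[X]/(Φ_v)
  termX : (∀ {e} → Vec F e → PolyX) → ∀ {e} → Vec F e → ℤ → PolyX
  termX κ a (+ n) = κ a ^X n
  termX κ a -[1+ n ] = bracket (monicPoly a) ^X suc n

  -- S_{<d}(s) computed in A (to be read mod v)
  Sless : (∀ {e} → Vec F e → Poly) → ℕ → List ℤ → Poly
  Sless ι = IterSums.S< elems 0P 1P _+P_ _*P_ (termA ι)

  -- H_{<d}(s; X) computed in A[X] (to be read mod Φ_v, i.e. at X = λ_v)
  Hless : (∀ {e} → Vec F e → PolyX) → ℕ → List ℤ → PolyX
  Hless κ = IterSums.S< elems 0X 1X _+X_ _*X_ (termX κ)

  -- reduction of an element of A[λ_v] = A[X]/(Φ_v) modulo (λ_v),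
  -- landing in A/(v): take the constant term (X ↦ 0)
  redλ : PolyX → Poly
  redλ = constTermX

-- Reduction modulo λ_v is evaluation at X = 0 on A[X]/(Φ_v): taking constant terms is a ring map
-- A[X] → A, and Φ_v = [v]_X has constant term v, so it induces A[λ_v] → A/(v). Since
-- C_θ(X) = θX + X^r with r ≥ 2, induction on a gives C_a(X) = aX + O(X²), so [a]_X has constant
-- term a. Hence [a]_λ reduces to a and its inverse to the inverse of a, so every term [a]_λ^(-s)
-- of H_{<d}(s; λ_v) reduces to the term a^(-s) of S_{<d}(s), and the ring map carries the
-- iterated sums along.

{-# OPTIONS --safe #-}
module Submission where

open import Level using (0ℓ; _⊔_)
open import Algebra.Bundles using (CommutativeRing; CommutativeSemigroup)
open import Data.Nat using (ℕ; zero; suc; _<_; _≤_; s≤s)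
open import Data.Nat.Properties using (<⇒≤; m<n⇒m<1+n; n<1+n)
open import Data.Integer using (ℤ; +_; -[1+_])
open import Data.List using (List; []; _∷_; map; concatMap; drop; length)
open import Data.List.Membership.Propositional using (_∈_)
open import Data.List.Membership.Propositional.Properties using (∈-length)
open import Data.List.Relation.Unary.Any using (here; there)
open import Data.List.Relation.Unary.All as All using (All; []; _∷_)
open import Data.Vec using (Vec; _∷_)
open import Data.Product using (Σ; _,_)
open import Data.Empty using (⊥-elim)
open import Relation.Binary.Bundles using (Setoid)
open import Relation.Binary.Structures using (IsEquivalence)
open import Relation.Binary.PropositionalEquality as ≡ using (_≡_; _≢_)
import Relation.Binary.Reasoning.Setoid
open import Defs
  using ( FiniteField; module PolyOps; module IterSums; Poly; PolyX; monicPoly; IrreducibleMonic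
        ; _∣A_; _∣X_; CongA; InvOracleA; InvOracleX; θ; Xv; Cθ; carlitz; bracket; termA; termX; Sless; Hless; redλ)

module Polynomial {ℓ} (R : CommutativeRing 0ℓ ℓ) where
  open CommutativeRing R
  module ≈-Reasoning = Relation.Binary.Reasoning.Setoid setoid
  open import Algebra.Properties.Ring ring using (-0#≈0#)
  open PolyOps 0# 1# _+_ _*_ -_ public

  coeff : Pol → ℕ → Carrier
  coeff []      n       = 0#
  coeff (a ∷ p) zero    = a
  coeff (a ∷ p) (suc n) = coeff p n

  infix 4 _≈ₚ_
  record _≈ₚ_ (p q : Pol) : Set ℓ where
    constructor coeffwise
    field coeff-≈ : ∀ n → coeff p n ≈ coeff q n
  open _≈ₚ_ public

  ≈ₚ-isEquivalence : IsEquivalence _≈ₚ_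
  ≈ₚ-isEquivalence = record
    { refl  = coeffwise λ _ → refl
    ; sym   = λ p≈q → coeffwise λ n → sym (coeff-≈ p≈q n)
    ; trans = λ p≈q q≈r → coeffwise λ n → trans (coeff-≈ p≈q n) (coeff-≈ q≈r n)
    }

  open IsEquivalence ≈ₚ-isEquivalence public
    using () renaming (refl to ≈ₚ-refl; sym to ≈ₚ-sym; trans to ≈ₚ-trans)

  ≈ₚ-setoid : Setoid 0ℓ ℓ
  ≈ₚ-setoid = record { isEquivalence = ≈ₚ-isEquivalence }

  module ≈ₚ-Reasoning = Relation.Binary.Reasoning.Setoid ≈ₚ-setoid

  ∷-cong : ∀ {a b p q} → a ≈ b → p ≈ₚ q → a ∷ p ≈ₚ b ∷ q
  ∷-cong a≈b p≈q = coeffwise λ { zero → a≈b ; (suc n) → coeff-≈ p≈q n }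

  ∷-≈0 : ∀ {a p} → a ≈ 0# → p ≈ₚ 0P → a ∷ p ≈ₚ 0P
  ∷-≈0 a≈0 p≈0 = coeffwise λ { zero → a≈0 ; (suc n) → coeff-≈ p≈0 n }

  coeff-drop₁ : ∀ p n → coeff (drop 1 p) n ≡ coeff p (suc n)
  coeff-drop₁ []      n = ≡.refl
  coeff-drop₁ (a ∷ p) n = ≡.refl

  constTerm≡coeff₀ : ∀ p → constTerm p ≡ coeff p 0
  constTerm≡coeff₀ []      = ≡.refl
  constTerm≡coeff₀ (a ∷ p) = ≡.refl

  allZero⇒≈0 : ∀ {p} → All (_≈ 0#) p → p ≈ₚ 0P
  allZero⇒≈0 []           = ≈ₚ-refl
  allZero⇒≈0 (a≈0 ∷ p≈0) = ∷-≈0 a≈0 (allZero⇒≈0 p≈0)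

  ≈0⇒allZero : ∀ p → p ≈ₚ 0P → All (_≈ 0#) p
  ≈0⇒allZero []      _   = []
  ≈0⇒allZero (a ∷ p) p≈0 = coeff-≈ p≈0 0 ∷ ≈0⇒allZero p (coeffwise λ n → coeff-≈ p≈0 (suc n))

  coeff-+ : ∀ p q n → coeff (p +P q) n ≈ coeff p n + coeff q n
  coeff-+ []      q       n       = sym (+-identityˡ _)
  coeff-+ (a ∷ p) []      n       = sym (+-identityʳ _)
  coeff-+ (a ∷ p) (b ∷ q) zero    = refl
  coeff-+ (a ∷ p) (b ∷ q) (suc n) = coeff-+ p q n

  coeff-scale : ∀ a p n → coeff (scale a p) n ≈ a * coeff p n
  coeff-scale a []      n       = sym (zeroʳ a)
  coeff-scale a (b ∷ p) zero    = refl
  coeff-scale a (b ∷ p) (suc n) = coeff-scale a p n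

  coeff-neg : ∀ p n → coeff (-P p) n ≈ - coeff p n
  coeff-neg []      n       = sym -0#≈0#
  coeff-neg (a ∷ p) zero    = refl
  coeff-neg (a ∷ p) (suc n) = coeff-neg p n

  +P-cong : ∀ {p p′ q q′} → p ≈ₚ p′ → q ≈ₚ q′ → p +P q ≈ₚ p′ +P q′
  +P-cong {p} {p′} {q} {q′} p≈p′ q≈q′ = coeffwise λ n → begin
    coeff (p +P q) n        ≈⟨ coeff-+ p q n ⟩
    coeff p n + coeff q n   ≈⟨ +-cong (coeff-≈ p≈p′ n) (coeff-≈ q≈q′ n) ⟩
    coeff p′ n + coeff q′ n ≈⟨ coeff-+ p′ q′ n ⟨
    coeff (p′ +P q′) n      ∎
    where open ≈-Reasoning

  +P-assoc : ∀ p q r → (p +P q) +P r ≈ₚ p +P (q +P r)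
  +P-assoc p q r = coeffwise λ n → begin
    coeff ((p +P q) +P r) n                ≈⟨ coeff-+ (p +P q) r n ⟩
    coeff (p +P q) n + coeff r n           ≈⟨ +-congʳ (coeff-+ p q n) ⟩
    (coeff p n + coeff q n) + coeff r n    ≈⟨ +-assoc _ _ _ ⟩
    coeff p n + (coeff q n + coeff r n)    ≈⟨ +-congˡ (coeff-+ q r n) ⟨
    coeff p n + coeff (q +P r) n           ≈⟨ coeff-+ p (q +P r) n ⟨
    coeff (p +P (q +P r)) n                ∎
    where open ≈-Reasoning

  +P-comm : ∀ p q → p +P q ≈ₚ q +P p
  +P-comm p q = coeffwise λ n → begin
    coeff (p +P q) n      ≈⟨ coeff-+ p q n ⟩
    coeff p n + coeff q n ≈⟨ +-comm _ _ ⟩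
    coeff q n + coeff p n ≈⟨ coeff-+ q p n ⟨
    coeff (q +P p) n      ∎
    where open ≈-Reasoning

  +P-identityʳ : ∀ p → p +P 0P ≈ₚ p
  +P-identityʳ []      = ≈ₚ-refl
  +P-identityʳ (a ∷ p) = ≈ₚ-refl

  -P-cong : ∀ {p q} → p ≈ₚ q → -P p ≈ₚ -P q
  -P-cong {p} {q} p≈q = coeffwise λ n → begin
    coeff (-P p) n ≈⟨ coeff-neg p n ⟩
    - coeff p n    ≈⟨ -‿cong (coeff-≈ p≈q n) ⟩
    - coeff q n    ≈⟨ coeff-neg q n ⟨
    coeff (-P q) n ∎
    where open ≈-Reasoning

  -P-inverseʳ : ∀ p → p +P (-P p) ≈ₚ 0P
  -P-inverseʳ p = coeffwise λ n → begin
    coeff (p +P (-P p)) n      ≈⟨ coeff-+ p (-P p) n ⟩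
    coeff p n + coeff (-P p) n ≈⟨ +-congˡ (coeff-neg p n) ⟩
    coeff p n - coeff p n      ≈⟨ -‿inverseʳ _ ⟩
    0#                         ∎
    where open ≈-Reasoning

  +P-commutativeSemigroup : CommutativeSemigroup 0ℓ ℓ
  +P-commutativeSemigroup = record
    { isCommutativeSemigroup = record
      { isSemigroup = record
        { isMagma = record { isEquivalence = ≈ₚ-isEquivalence ; ∙-cong = +P-cong }
        ; assoc   = +P-assoc
        }
      ; comm = +P-comm
      }
    }

  open import Algebra.Properties.CommutativeSemigroup +P-commutativeSemigroup
    using () renaming (interchange to +P-interchange; x∙yz≈y∙xz to +P-swapˡ)

  scale-cong : ∀ {a b p q} → a ≈ b → p ≈ₚ q → scale a p ≈ₚ scale b q
  scale-cong {a} {b} {p} {q} a≈b p≈q = coeffwise λ n → begin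
    coeff (scale a p) n ≈⟨ coeff-scale a p n ⟩
    a * coeff p n       ≈⟨ *-cong a≈b (coeff-≈ p≈q n) ⟩
    b * coeff q n       ≈⟨ coeff-scale b q n ⟨
    coeff (scale b q) n ∎
    where open ≈-Reasoning

  scale-distribˡ : ∀ a p q → scale a (p +P q) ≈ₚ scale a p +P scale a q
  scale-distribˡ a p q = coeffwise λ n → begin
    coeff (scale a (p +P q)) n                  ≈⟨ coeff-scale a (p +P q) n ⟩
    a * coeff (p +P q) n                        ≈⟨ *-congˡ (coeff-+ p q n) ⟩
    a * (coeff p n + coeff q n)                 ≈⟨ distribˡ a _ _ ⟩
    a * coeff p n + a * coeff q n               ≈⟨ +-cong (coeff-scale a p n) (coeff-scale a q n) ⟨
    coeff (scale a p) n + coeff (scale a q) n   ≈⟨ coeff-+ (scale a p) (scale a q) n ⟨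
    coeff (scale a p +P scale a q) n            ∎
    where open ≈-Reasoning

  scale-distribʳ : ∀ a b p → scale (a + b) p ≈ₚ scale a p +P scale b p
  scale-distribʳ a b p = coeffwise λ n → begin
    coeff (scale (a + b) p) n                   ≈⟨ coeff-scale (a + b) p n ⟩
    (a + b) * coeff p n                         ≈⟨ distribʳ _ a b ⟩
    a * coeff p n + b * coeff p n               ≈⟨ +-cong (coeff-scale a p n) (coeff-scale b p n) ⟨
    coeff (scale a p) n + coeff (scale b p) n   ≈⟨ coeff-+ (scale a p) (scale b p) n ⟨
    coeff (scale a p +P scale b p) n            ∎
    where open ≈-Reasoning

  scale-assoc : ∀ a b p → scale (a * b) p ≈ₚ scale a (scale b p)
  scale-assoc a b p = coeffwise λ n → begin
    coeff (scale (a * b) p) n       ≈⟨ coeff-scale (a * b) p n ⟩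
    (a * b) * coeff p n             ≈⟨ *-assoc a b _ ⟩
    a * (b * coeff p n)             ≈⟨ *-congˡ (coeff-scale b p n) ⟨
    a * coeff (scale b p) n         ≈⟨ coeff-scale a (scale b p) n ⟨
    coeff (scale a (scale b p)) n   ∎
    where open ≈-Reasoning

  scale-zero : ∀ p → scale 0# p ≈ₚ 0P
  scale-zero p = coeffwise λ n → trans (coeff-scale 0# p n) (zeroˡ _)

  scale-identity : ∀ p → scale 1# p ≈ₚ p
  scale-identity p = coeffwise λ n → trans (coeff-scale 1# p n) (*-identityˡ _)

  *P-zeroʳ : ∀ p → p *P 0P ≈ₚ 0P
  *P-zeroʳ []      = ≈ₚ-refl
  *P-zeroʳ (a ∷ p) = ∷-≈0 refl (*P-zeroʳ p)

  *P-congʳ : ∀ p {q q′} → q ≈ₚ q′ → p *P q ≈ₚ p *P q′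
  *P-congʳ []      q≈q′ = ≈ₚ-refl
  *P-congʳ (a ∷ p) q≈q′ = +P-cong (scale-cong refl q≈q′) (∷-cong refl (*P-congʳ p q≈q′))

  *P-shift : ∀ p b q → p *P (b ∷ q) ≈ₚ scale b p +P (0# ∷ p *P q)
  *P-shift []      b q = ≈ₚ-sym (∷-≈0 refl ≈ₚ-refl)
  *P-shift (a ∷ p) b q = ∷-cong (+-congʳ (*-comm a b))
    (≈ₚ-trans (+P-cong ≈ₚ-refl (*P-shift p b q)) (+P-swapˡ (scale a q) (scale b p) (0# ∷ p *P q)))

  *P-comm : ∀ p q → p *P q ≈ₚ q *P p
  *P-comm []      q = ≈ₚ-sym (*P-zeroʳ q)
  *P-comm (a ∷ p) q = ≈ₚ-trans (+P-cong ≈ₚ-refl (∷-cong refl (*P-comm p q))) (≈ₚ-sym (*P-shift q a p))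

  *P-cong : ∀ {p p′ q q′} → p ≈ₚ p′ → q ≈ₚ q′ → p *P q ≈ₚ p′ *P q′
  *P-cong {p} {p′} {q} {q′} p≈p′ q≈q′ = begin
    p *P q   ≈⟨ *P-congʳ p q≈q′ ⟩
    p *P q′  ≈⟨ *P-comm p q′ ⟩
    q′ *P p  ≈⟨ *P-congʳ q′ p≈p′ ⟩
    q′ *P p′ ≈⟨ *P-comm q′ p′ ⟩
    p′ *P q′ ∎
    where open ≈ₚ-Reasoning

  *P-distribʳ : ∀ p q r → (p +P q) *P r ≈ₚ (p *P r) +P (q *P r)
  *P-distribʳ []      q       r = ≈ₚ-refl
  *P-distribʳ (a ∷ p) []      r = ≈ₚ-sym (+P-identityʳ _)
  *P-distribʳ (a ∷ p) (b ∷ q) r = begin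
    scale (a + b) r +P (0# ∷ (p +P q) *P r)
      ≈⟨ +P-cong (scale-distribʳ a b r) (∷-cong (sym (+-identityˡ 0#)) (*P-distribʳ p q r)) ⟩
    (scale a r +P scale b r) +P ((0# ∷ p *P r) +P (0# ∷ q *P r))
      ≈⟨ +P-interchange (scale a r) (scale b r) (0# ∷ p *P r) (0# ∷ q *P r) ⟩
    ((a ∷ p) *P r) +P ((b ∷ q) *P r) ∎
    where open ≈ₚ-Reasoning

  *P-distribˡ : ∀ p q r → p *P (q +P r) ≈ₚ (p *P q) +P (p *P r)
  *P-distribˡ p q r = begin
    p *P (q +P r)       ≈⟨ *P-comm p (q +P r) ⟩
    (q +P r) *P p       ≈⟨ *P-distribʳ q r p ⟩
    (q *P p) +P (r *P p) ≈⟨ +P-cong (*P-comm q p) (*P-comm r p) ⟩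
    (p *P q) +P (p *P r) ∎
    where open ≈ₚ-Reasoning

  scale-*P : ∀ a p q → scale a p *P q ≈ₚ scale a (p *P q)
  scale-*P a []      q = ≈ₚ-refl
  scale-*P a (b ∷ p) q = begin
    scale (a * b) q +P (0# ∷ scale a p *P q)
      ≈⟨ +P-cong (scale-assoc a b q) (∷-cong (sym (zeroʳ a)) (scale-*P a p q)) ⟩
    scale a (scale b q) +P scale a (0# ∷ p *P q)
      ≈⟨ scale-distribˡ a (scale b q) (0# ∷ p *P q) ⟨
    scale a ((b ∷ p) *P q) ∎
    where open ≈ₚ-Reasoning

  *P-assoc : ∀ p q r → (p *P q) *P r ≈ₚ p *P (q *P r)
  *P-assoc []      q r = ≈ₚ-refl
  *P-assoc (a ∷ p) q r = begin
    (scale a q +P (0# ∷ p *P q)) *P r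
      ≈⟨ *P-distribʳ (scale a q) (0# ∷ p *P q) r ⟩
    (scale a q *P r) +P ((0# ∷ p *P q) *P r)
      ≈⟨ +P-cong (scale-*P a q r) (+P-cong (scale-zero r) ≈ₚ-refl) ⟩
    scale a (q *P r) +P (0# ∷ (p *P q) *P r)
      ≈⟨ +P-cong ≈ₚ-refl (∷-cong refl (*P-assoc p q r)) ⟩
    (a ∷ p) *P (q *P r) ∎
    where open ≈ₚ-Reasoning

  *P-identityˡ : ∀ p → 1P *P p ≈ₚ p
  *P-identityˡ p =
    ≈ₚ-trans (+P-cong ≈ₚ-refl (∷-≈0 refl ≈ₚ-refl)) (≈ₚ-trans (+P-identityʳ _) (scale-identity p))

  commutativeRing : CommutativeRing 0ℓ ℓ
  commutativeRing = record
    { Carrier = Pol ; _≈_ = _≈ₚ_ ; _+_ = _+P_ ; _*_ = _*P_ ; -_ = -P_ ; 0# = 0P ; 1# = 1P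
    ; isCommutativeRing = record
      { isRing = record
        { +-isAbelianGroup = record
          { isGroup = record
            { isMonoid = record
              { isSemigroup = CommutativeSemigroup.isSemigroup +P-commutativeSemigroup
              ; identity    = (λ _ → ≈ₚ-refl) , +P-identityʳ
              }
            ; inverse = (λ p → ≈ₚ-trans (+P-comm (-P p) p) (-P-inverseʳ p)) , -P-inverseʳ
            ; ⁻¹-cong = -P-cong
            }
          ; comm = +P-comm
          }
        ; *-cong     = *P-cong
        ; *-assoc    = *P-assoc
        ; *-identity = *P-identityˡ , (λ p → ≈ₚ-trans (*P-comm p 1P) (*P-identityˡ p))
        ; distrib    = *P-distribˡ , (λ r p q → *P-distribʳ p q r)
        }
      ; *-comm = *P-comm
      }
    }

  coeff₀-* : ∀ p q → coeff (p *P q) 0 ≈ coeff p 0 * coeff q 0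
  coeff₀-* []      q = sym (zeroˡ _)
  coeff₀-* (a ∷ p) q = trans (coeff-+ (scale a q) (0# ∷ p *P q) 0) (trans (+-identityʳ _) (coeff-scale a q 0))

  coeff₁-* : ∀ p q → coeff (p *P q) 1 ≈ coeff p 0 * coeff q 1 + coeff p 1 * coeff q 0
  coeff₁-* []      q = sym (trans (+-cong (zeroˡ _) (zeroˡ _)) (+-identityˡ 0#))
  coeff₁-* (a ∷ p) q = trans (coeff-+ (scale a q) (0# ∷ p *P q) 1) (+-cong (coeff-scale a q 1) (coeff₀-* p q))

  coeff₀-^ : ∀ f → coeff f 0 ≈ 0# → ∀ {n} → 1 ≤ n → coeff (f ^P n) 0 ≈ 0#
  coeff₀-^ f f₀≈0 {suc n} _ = trans (coeff₀-* f (f ^P n)) (trans (*-congʳ f₀≈0) (zeroˡ _))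

  coeff₁-^ : ∀ f → coeff f 0 ≈ 0# → ∀ {n} → 2 ≤ n → coeff (f ^P n) 1 ≈ 0#
  coeff₁-^ f f₀≈0 {suc n} (s≤s 1≤n) = begin
    coeff (f ^P suc n) 1
      ≈⟨ coeff₁-* f (f ^P n) ⟩
    coeff f 0 * coeff (f ^P n) 1 + coeff f 1 * coeff (f ^P n) 0
      ≈⟨ +-cong (*-congʳ f₀≈0) (*-congˡ (coeff₀-^ f f₀≈0 1≤n)) ⟩
    0# * coeff (f ^P n) 1 + coeff f 1 * 0#
      ≈⟨ +-cong (zeroˡ _) (zeroʳ _) ⟩
    0# + 0#
      ≈⟨ +-identityˡ 0# ⟩
    0# ∎
    where open ≈-Reasoning


module Congruence {c ℓ} (R : CommutativeRing c ℓ) (m : CommutativeRing.Carrier R) where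
  open CommutativeRing R
  open import Algebra.Properties.Ring ring using (-1*x≈-x; x[y-z]≈xy-xz; [y-z]x≈yx-zx)
  open import Algebra.Properties.AbelianGroup +-abelianGroup using (⁻¹-anti-homo‿-; ⁻¹-∙-comm)
  open import Algebra.Properties.Group +-group using (x≈y⇒x∙y⁻¹≈ε)
  open import Algebra.Properties.CommutativeSemigroup +-commutativeSemigroup using (interchange)
  open import Algebra.Properties.Semigroup.Divisibility *-semigroup using (_∣_; _,_; ∣ʳ-respʳ-≈; x∣ʳy⇒x∣ʳzy)
  module ≈-Reasoning = Relation.Binary.Reasoning.Setoid setoid

  [x-y]+[y-z]≈x-z : ∀ x y z → (x - y) + (y - z) ≈ x - z
  [x-y]+[y-z]≈x-z x y z = begin
    (x - y) + (y - z)   ≈⟨ +-assoc x (- y) (y - z) ⟩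
    x + (- y + (y - z)) ≈⟨ +-congˡ (sym (+-assoc (- y) y (- z))) ⟩
    x + ((- y + y) - z) ≈⟨ +-congˡ (+-congʳ (-‿inverseˡ y)) ⟩
    x + (0# - z)        ≈⟨ +-congˡ (+-identityˡ (- z)) ⟩
    x - z               ∎
    where open ≈-Reasoning

  ∣-+ : ∀ {x y} → m ∣ x → m ∣ y → m ∣ x + y
  ∣-+ (p , pm≈x) (q , qm≈y) = p + q , trans (distribʳ m p q) (+-cong pm≈x qm≈y)

  ∣0 : m ∣ 0#
  ∣0 = 0# , zeroˡ m

  infix 4 _≈ₘ_
  record _≈ₘ_ (x y : Carrier) : Set (c ⊔ ℓ) where
    constructor mk≈ₘ
    field m∣x-y : m ∣ x - y
  open _≈ₘ_ public

  ≈⇒≈ₘ : ∀ {x y} → x ≈ y → x ≈ₘ y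
  ≈⇒≈ₘ x≈y = mk≈ₘ (∣ʳ-respʳ-≈ (sym (x≈y⇒x∙y⁻¹≈ε x≈y)) ∣0)

  ≈ₘ-sym : ∀ {x y} → x ≈ₘ y → y ≈ₘ x
  ≈ₘ-sym {x} {y} (mk≈ₘ m∣x-y) =
    mk≈ₘ (∣ʳ-respʳ-≈ (trans (-1*x≈-x (x - y)) (⁻¹-anti-homo‿- x y)) (x∣ʳy⇒x∣ʳzy (- 1#) m∣x-y))

  ≈ₘ-trans : ∀ {x y z} → x ≈ₘ y → y ≈ₘ z → x ≈ₘ z
  ≈ₘ-trans {x} {y} {z} (mk≈ₘ m∣x-y) (mk≈ₘ m∣y-z) =
    mk≈ₘ (∣ʳ-respʳ-≈ ([x-y]+[y-z]≈x-z x y z) (∣-+ m∣x-y m∣y-z))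

  ≈ₘ-isEquivalence : IsEquivalence _≈ₘ_
  ≈ₘ-isEquivalence = record { refl = ≈⇒≈ₘ refl ; sym = ≈ₘ-sym ; trans = ≈ₘ-trans }

  ≈ₘ-setoid : Setoid c (c ⊔ ℓ)
  ≈ₘ-setoid = record { isEquivalence = ≈ₘ-isEquivalence }

  +-cong-≈ₘ : ∀ {x x′ y y′} → x ≈ₘ x′ → y ≈ₘ y′ → x + y ≈ₘ x′ + y′
  +-cong-≈ₘ {x} {x′} {y} {y′} (mk≈ₘ m∣x-x′) (mk≈ₘ m∣y-y′) =
    mk≈ₘ (∣ʳ-respʳ-≈ regroup (∣-+ m∣x-x′ m∣y-y′))
    where
    regroup : (x - x′) + (y - y′) ≈ (x + y) - (x′ + y′)
    regroup = trans (interchange x (- x′) y (- y′)) (+-congˡ (⁻¹-∙-comm x′ y′))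

  *-cong-≈ₘ : ∀ {x x′ y y′} → x ≈ₘ x′ → y ≈ₘ y′ → x * y ≈ₘ x′ * y′
  *-cong-≈ₘ {x} {x′} {y} {y′} (mk≈ₘ m∣x-x′) (mk≈ₘ m∣y-y′) =
    mk≈ₘ (∣ʳ-respʳ-≈ regroup (∣-+ (x∣ʳy⇒x∣ʳzy x m∣y-y′) m∣[x-x′]y′))
    where
    m∣[x-x′]y′ : m ∣ (x - x′) * y′
    m∣[x-x′]y′ = ∣ʳ-respʳ-≈ (*-comm y′ (x - x′)) (x∣ʳy⇒x∣ʳzy y′ m∣x-x′)
    regroup : x * (y - y′) + (x - x′) * y′ ≈ x * y - x′ * y′
    regroup = trans (+-cong (x[y-z]≈xy-xz x y y′) ([y-z]x≈yx-zx y′ x x′))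
                    ([x-y]+[y-z]≈x-z (x * y) (x * y′) (x′ * y′))

  inverse-unique-≈ₘ : ∀ {a i k} → a * i ≈ₘ 1# → a * k ≈ₘ 1# → i ≈ₘ k
  inverse-unique-≈ₘ {a} {i} {k} ai≈1 ak≈1 = begin
    i           ≈⟨ ≈⇒≈ₘ (sym (*-identityʳ i)) ⟩
    i * 1#      ≈⟨ *-cong-≈ₘ (≈⇒≈ₘ refl) (≈ₘ-sym ak≈1) ⟩
    i * (a * k) ≈⟨ ≈⇒≈ₘ (trans (sym (*-assoc i a k)) (*-congʳ (*-comm i a))) ⟩
    (a * i) * k ≈⟨ *-cong-≈ₘ ai≈1 (≈⇒≈ₘ refl) ⟩
    1# * k      ≈⟨ ≈⇒≈ₘ (*-identityˡ k) ⟩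
    k           ∎
    where open Relation.Binary.Reasoning.Setoid ≈ₘ-setoid


module IterSumsRelation {F R R′ : Set} (elems : List F)
  (0R 1R : R) (_⊕_ _⊗_ : R → R → R) (0R′ 1R′ : R′) (_⊕′_ _⊗′_ : R′ → R′ → R′)
  (_∼_ : R → R′ → Set) (0∼0 : 0R ∼ 0R′) (1∼1 : 1R ∼ 1R′)
  (⊕-∼ : ∀ {x x′ y y′} → x ∼ x′ → y ∼ y′ → (x ⊕ y) ∼ (x′ ⊕′ y′))
  (⊗-∼ : ∀ {x x′ y y′} → x ∼ x′ → y ∼ y′ → (x ⊗ y) ∼ (x′ ⊗′ y′))
  (term : ∀ {e} → Vec F e → ℤ → R) (term′ : ∀ {e} → Vec F e → ℤ → R′)
  where

  module L = IterSums elems 0R 1R _⊕_ _⊗_ term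
  module L′ = IterSums elems 0R′ 1R′ _⊕′_ _⊗′_ term′

  -- monics ignores the ring parameters, yet its two instances agree only propositionally.
  monics≡monics′ : ∀ d → L.monics d ≡ L′.monics d
  monics≡monics′ zero    = ≡.refl
  monics≡monics′ (suc d) = ≡.cong (λ ms → concatMap (λ x → map (x ∷_) ms) elems) (monics≡monics′ d)

  sum-∼ : ∀ {A : Set} (f : A → R) (f′ : A → R′) (xs : List A) → (∀ x → f x ∼ f′ x) →
          L.sumR (map f xs) ∼ L′.sumR (map f′ xs)
  sum-∼ f f′ []       f∼f′ = 0∼0
  sum-∼ f f′ (x ∷ xs) f∼f′ = ⊕-∼ (f∼f′ x) (sum-∼ f f′ xs f∼f′)

  Sd-∼ : ∀ d s → (∀ (a : Vec F d) → term a s ∼ term′ a s) → L.Sd d s ∼ L′.Sd d s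
  Sd-∼ d s term∼term′ rewrite monics≡monics′ d =
    sum-∼ (λ a → term a s) (λ a → term′ a s) (L′.monics d) term∼term′

  S<-∼ : ∀ n → (∀ e → e < n → (a : Vec F e) → ∀ s → term a s ∼ term′ a s) →
         ∀ s → L.S< n s ∼ L′.S< n s
  S<-∼ n       term∼term′ []       = 1∼1
  S<-∼ zero    term∼term′ (s ∷ ss) = 0∼0
  S<-∼ (suc n) term∼term′ (s ∷ ss) =
    ⊕-∼ (S<-∼ n below (s ∷ ss)) (⊗-∼ (Sd-∼ n s λ a → term∼term′ n (n<1+n n) a s) (S<-∼ n below ss))
    where
    below : ∀ e → e < n → (a : Vec F e) → ∀ s → term a s ∼ term′ a s
    below e e<n = term∼term′ e (m<n⇒m<1+n e<n)


2≤length : ∀ {A : Set} {x y : A} {xs} → x ≢ y → x ∈ xs → y ∈ xs → 2 ≤ length xs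
2≤length x≢y (here ≡.refl) (here ≡.refl) = ⊥-elim (x≢y ≡.refl)
2≤length _   (here _)      (there y∈xs)  = s≤s (∈-length y∈xs)
2≤length _   (there x∈xs)  _             = s≤s (∈-length x∈xs)


module CarlitzReduction (𝔽 : FiniteField) where
  open FiniteField 𝔽 using (F; 0F; 1F; 0≢1; elems; complete; r; isCommutativeRing)

  𝔽-ring : CommutativeRing 0ℓ 0ℓ
  𝔽-ring = record { isCommutativeRing = isCommutativeRing }

  open Polynomial 𝔽-ring
  module 𝔸 = CommutativeRing commutativeRing
  module X = Polynomial commutativeRing
  open import Algebra.Properties.Group 𝔸.+-group using (x∙y⁻¹≈ε⇒x≈y; x≈y⇒x∙y⁻¹≈ε)
  open import Algebra.Properties.Group (CommutativeRing.+-group X.commutativeRing)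
    using () renaming (x∙y⁻¹≈ε⇒x≈y to X-x∙y⁻¹≈ε⇒x≈y)

  2≤r : 2 ≤ r
  2≤r = 2≤length 0≢1 (complete 0F) (complete 1F)

  θ*P : ∀ a → θ 𝔽 *P a ≈ₚ 0F ∷ a
  θ*P a = +P-cong (scale-zero a) (∷-cong ≡.refl (*P-identityˡ a))

  Cθ-coeff₀ : ∀ f → X.coeff f 0 ≈ₚ 0P → X.coeff (Cθ 𝔽 f) 0 ≈ₚ 0P
  Cθ-coeff₀ f f₀≈0 = begin
    X.coeff (Cθ 𝔽 f) 0
      ≈⟨ X.coeff-+ (X.scale (θ 𝔽) f) (f X.^P r) 0 ⟩
    X.coeff (X.scale (θ 𝔽) f) 0 +P X.coeff (f X.^P r) 0
      ≈⟨ 𝔸.+-cong (X.coeff-scale (θ 𝔽) f 0) (X.coeff₀-^ f f₀≈0 (<⇒≤ 2≤r)) ⟩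
    (θ 𝔽 *P X.coeff f 0) +P 0P
      ≈⟨ 𝔸.+-identityʳ _ ⟩
    θ 𝔽 *P X.coeff f 0
      ≈⟨ *P-congʳ (θ 𝔽) f₀≈0 ⟩
    θ 𝔽 *P 0P
      ≈⟨ 𝔸.zeroʳ (θ 𝔽) ⟩
    0P ∎
    where open ≈ₚ-Reasoning

  Cθ-coeff₁ : ∀ f → X.coeff f 0 ≈ₚ 0P → X.coeff (Cθ 𝔽 f) 1 ≈ₚ θ 𝔽 *P X.coeff f 1
  Cθ-coeff₁ f f₀≈0 = begin
    X.coeff (Cθ 𝔽 f) 1
      ≈⟨ X.coeff-+ (X.scale (θ 𝔽) f) (f X.^P r) 1 ⟩
    X.coeff (X.scale (θ 𝔽) f) 1 +P X.coeff (f X.^P r) 1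
      ≈⟨ 𝔸.+-cong (X.coeff-scale (θ 𝔽) f 1) (X.coeff₁-^ f f₀≈0 2≤r) ⟩
    (θ 𝔽 *P X.coeff f 1) +P 0P
      ≈⟨ 𝔸.+-identityʳ _ ⟩
    θ 𝔽 *P X.coeff f 1 ∎
    where open ≈ₚ-Reasoning

  carlitz-coeff₀ : ∀ a → X.coeff (carlitz 𝔽 a) 0 ≈ₚ 0P
  carlitz-coeff₀ []      = ≈ₚ-refl
  carlitz-coeff₀ (c ∷ a) = begin
    X.coeff (carlitz 𝔽 (c ∷ a)) 0
      ≈⟨ X.coeff-+ (X.scale (c ∷ []) (Xv 𝔽)) (Cθ 𝔽 (carlitz 𝔽 a)) 0 ⟩
    ((c ∷ []) *P 0P) +P X.coeff (Cθ 𝔽 (carlitz 𝔽 a)) 0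
      ≈⟨ 𝔸.+-cong (𝔸.zeroʳ (c ∷ [])) (Cθ-coeff₀ (carlitz 𝔽 a) (carlitz-coeff₀ a)) ⟩
    0P +P 0P
      ≈⟨ 𝔸.+-identityˡ 0P ⟩
    0P ∎
    where open ≈ₚ-Reasoning

  carlitz-coeff₁ : ∀ a → X.coeff (carlitz 𝔽 a) 1 ≈ₚ a
  carlitz-coeff₁ []      = ≈ₚ-refl
  carlitz-coeff₁ (c ∷ a) = begin
    X.coeff (carlitz 𝔽 (c ∷ a)) 1
      ≈⟨ X.coeff-+ (X.scale (c ∷ []) (Xv 𝔽)) (Cθ 𝔽 (carlitz 𝔽 a)) 1 ⟩
    ((c ∷ []) *P 1P) +P X.coeff (Cθ 𝔽 (carlitz 𝔽 a)) 1
      ≈⟨ 𝔸.+-cong (𝔸.*-identityʳ (c ∷ [])) (Cθ-coeff₁ (carlitz 𝔽 a) (carlitz-coeff₀ a)) ⟩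
    (c ∷ []) +P (θ 𝔽 *P X.coeff (carlitz 𝔽 a) 1)
      ≈⟨ 𝔸.+-congˡ {c ∷ []} (≈ₚ-trans (*P-congʳ (θ 𝔽) (carlitz-coeff₁ a)) (θ*P a)) ⟩
    (c ∷ []) +P (0F ∷ a)
      ≈⟨ ∷-cong (CommutativeRing.+-identityʳ 𝔽-ring c) ≈ₚ-refl ⟩
    c ∷ a ∎
    where open ≈ₚ-Reasoning

  bracket-coeff₀ : ∀ a → X.coeff (bracket 𝔽 a) 0 ≈ₚ a
  bracket-coeff₀ a = 𝔸.trans (𝔸.reflexive (X.coeff-drop₁ (carlitz 𝔽 a) 0)) (carlitz-coeff₁ a)

  open import Algebra.Properties.Semigroup.Divisibility 𝔸.*-semigroup
    using (_∣_; _,_; ∣ʳ-respʳ-≈; ∣ʳ-respˡ-≈)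

  ∣A⇒∣ : ∀ {v f} → _∣A_ 𝔽 v f → v ∣ f
  ∣A⇒∣ (c , cv-f≈0) = c , x∙y⁻¹≈ε⇒x≈y _ _ (allZero⇒≈0 cv-f≈0)

  ∣⇒∣A : ∀ {v f} → v ∣ f → _∣A_ 𝔽 v f
  ∣⇒∣A (c , cv≈f) = c , ≈0⇒allZero _ (x≈y⇒x∙y⁻¹≈ε cv≈f)

  ∣X⇒coeff₀∣ : ∀ {g f} → _∣X_ 𝔽 g f → X.coeff g 0 ∣ X.coeff f 0
  ∣X⇒coeff₀∣ {g} {f} (c , cg-f≈0) = X.coeff c 0 , 𝔸.trans (𝔸.sym (X.coeff₀-* c g)) (X.coeff-≈ cg≈f 0)
    where
    cg≈f : c X.*P g X.≈ₚ f
    cg≈f = X-x∙y⁻¹≈ε⇒x≈y _ _ (X.allZero⇒≈0 (All.map allZero⇒≈0 cg-f≈0))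

  module _ {d} (v : Vec F d) where
    open Congruence commutativeRing (monicPoly 𝔽 v) renaming (_≈ₘ_ to _≈ᵥ_)

    -- x ∼ f: the reduction of f(λ_v) modulo λ_v is x.
    infix 4 _∼_
    record _∼_ (x : Poly 𝔽) (f : PolyX 𝔽) : Set where
      constructor ≈ᵥcoeff₀
      field ≈ᵥ-coeff₀ : x ≈ᵥ X.coeff f 0
    open _∼_

    ∼-0 : 0P ∼ X.0P
    ∼-0 = ≈ᵥcoeff₀ (≈⇒≈ₘ 𝔸.refl)

    ∼-1 : 1P ∼ X.1P
    ∼-1 = ≈ᵥcoeff₀ (≈⇒≈ₘ 𝔸.refl)

    ∼-+ : ∀ {x f y g} → x ∼ f → y ∼ g → x +P y ∼ f X.+P g
    ∼-+ {f = f} {g = g} (≈ᵥcoeff₀ x≈f₀) (≈ᵥcoeff₀ y≈g₀) =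
      ≈ᵥcoeff₀ (≈ₘ-trans (+-cong-≈ₘ x≈f₀ y≈g₀) (≈⇒≈ₘ (𝔸.sym (X.coeff-+ f g 0))))

    ∼-* : ∀ {x f y g} → x ∼ f → y ∼ g → x *P y ∼ f X.*P g
    ∼-* {f = f} {g = g} (≈ᵥcoeff₀ x≈f₀) (≈ᵥcoeff₀ y≈g₀) =
      ≈ᵥcoeff₀ (≈ₘ-trans (*-cong-≈ₘ x≈f₀ y≈g₀) (≈⇒≈ₘ (𝔸.sym (X.coeff₀-* f g))))

    ∼-^ : ∀ {x f} → x ∼ f → ∀ n → x ^P n ∼ f X.^P n
    ∼-^ x∼f zero    = ∼-1
    ∼-^ x∼f (suc n) = ∼-* x∼f (∼-^ x∼f n)

    a∼[a] : ∀ a → a ∼ bracket 𝔽 a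
    a∼[a] a = ≈ᵥcoeff₀ (≈⇒≈ₘ (𝔸.sym (bracket-coeff₀ a)))

    module _ (ι : ∀ {e} → Vec F e → Poly 𝔽) (ι-inv : InvOracleA 𝔽 v ι)
             (κ : ∀ {e} → Vec F e → PolyX 𝔽) (κ-inv : InvOracleX 𝔽 v κ) where

      κ₀-inverse : ∀ e → e < d → (a : Vec F e) → monicPoly 𝔽 a *P X.coeff (κ a) 0 ≈ᵥ 1P
      κ₀-inverse e e<d a =
        mk≈ₘ (∣ʳ-respʳ-≈ coeff₀[[a]κ-1] (∣ʳ-respˡ-≈ (bracket-coeff₀ (monicPoly 𝔽 v)) Φ₀∣))
        where
        [a] : PolyX 𝔽
        [a] = bracket 𝔽 (monicPoly 𝔽 a)
        Φ₀∣ : X.coeff (bracket 𝔽 (monicPoly 𝔽 v)) 0 ∣ X.coeff (([a] X.*P κ a) X.-P X.1P) 0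
        Φ₀∣ = ∣X⇒coeff₀∣ (κ-inv e e<d a)
        coeff₀[[a]κ-1] : X.coeff (([a] X.*P κ a) X.-P X.1P) 0 ≈ₚ (monicPoly 𝔽 a *P X.coeff (κ a) 0) -P 1P
        coeff₀[[a]κ-1] = 𝔸.trans (X.coeff-+ ([a] X.*P κ a) (X.-P X.1P) 0)
          (𝔸.+-congʳ (𝔸.trans (X.coeff₀-* [a] (κ a)) (𝔸.*-congʳ (bracket-coeff₀ (monicPoly 𝔽 a)))))

      ι∼κ : ∀ e → e < d → (a : Vec F e) → ι a ∼ κ a
      ι∼κ e e<d a =
        ≈ᵥcoeff₀ (inverse-unique-≈ₘ {monicPoly 𝔽 a} (mk≈ₘ (∣A⇒∣ (ι-inv e e<d a)))
                                                    (κ₀-inverse e e<d a))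

      termA∼termX : ∀ e → e < d → (a : Vec F e) → ∀ s → termA 𝔽 ι a s ∼ termX 𝔽 κ a s
      termA∼termX e e<d a (+ n)    = ∼-^ (ι∼κ e e<d a) n
      termA∼termX e e<d a -[1+ n ] = ∼-^ (a∼[a] (monicPoly 𝔽 a)) (suc n)

      Sless∼Hless : ∀ s → Sless 𝔽 ι d s ∼ Hless 𝔽 κ d s
      Sless∼Hless = S<-∼ d termA∼termX
        where
        open IterSumsRelation elems 0P 1P _+P_ _*P_ X.0P X.1P X._+P_ X._*P_
          _∼_ ∼-0 ∼-1 ∼-+ ∼-* (termA 𝔽 ι) (termX 𝔽 κ)

      Sless≡redλ-Hless : ∀ s → CongA 𝔽 (monicPoly 𝔽 v) (Sless 𝔽 ι d s) (redλ 𝔽 (Hless 𝔽 κ d s))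
      Sless≡redλ-Hless s =
        ≡.subst (CongA 𝔽 (monicPoly 𝔽 v) (Sless 𝔽 ι d s)) (≡.sym (X.constTerm≡coeff₀ (Hless 𝔽 κ d s)))
                (∣⇒∣A (m∣x-y (≈ᵥ-coeff₀ (Sless∼Hless s))))


theorem3p19 : (𝔽 : FiniteField) → (s : List ℤ) →
    Σ ℕ λ N → ∀ d (v : Vec (FiniteField.F 𝔽) d) → N ≤ d →
      IrreducibleMonic 𝔽 v →
      (ι : ∀ {e} → Vec (FiniteField.F 𝔽) e → Poly 𝔽) → InvOracleA 𝔽 v ι →
      (κ : ∀ {e} → Vec (FiniteField.F 𝔽) e → PolyX 𝔽) → InvOracleX 𝔽 v κ →
      CongA 𝔽 (monicPoly 𝔽 v) (Sless 𝔽 ι d s) (redλ 𝔽 (Hless 𝔽 κ d s))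
-- No bound on deg v and no irreducibility are needed: the oracles ι and κ already supply the
-- inverses that irreducibility of v would guarantee.
theorem3p19 𝔽 s = 0 , λ d v _ _ ι ι-inv κ κ-inv →
  CarlitzReduction.Sless≡redλ-Hless 𝔽 v ι ι-inv κ κ-inv s
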